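{- Let $n\ge 4$ and let $S$ be an inductive strategy of length $n$ with $S\neq CS$, i.e. $S[n]\neq[2,3,\dots,n,1]$. Then $[x^3]f_{CS}(x)>[x^3]f_S(x)$, where $CS$ is the cyclic shift strategy of length $n$.
   Context: Permutation wordle on $[n]=\{1,\dots,n\}$: a secret permutation $\pi\in S_n$ (one-line notation) is fixed. The first guess is $\gamma_1=[1,2,\dots,n]$. After guess $\gamma_r$ the guesser learns $\mathcal{J}_r=\{i:\gamma_r(i)=\pi(i)\}$; $\mathcal{I}_r=[n]\setminus\mathcal{J}_r$. The game ends at the first $r$ with $\mathcal{J}_r=[n]$. A strategy of length $n$ is a sequence $S=(S[1],\dots,S[n])$ with $S[k]$ a permutation of $[k]$; if $\mathcal{I}_r=\{i_1<\dots<i_k\}\neq\emptyset$ and $\sigma=S[k]$, then $\gamma_{r+1}(i)=\gamma_r(i)$ for $i\in\mathcal{J}_r$ and $\gamma_{r+1}(i_{\sigma(j)})=\gamma_r(i_j)$ for $j=1,\dots,k$. $f_S(x)=\sum_r a_rx^r$ where $a_r$ is the number of $\pi\in S_n$ for which the game with $S$ ends after exactly $r$ guesses. The cyclic shift strategy $CS$ has $CS[k]=[2,3,\dots,k,1]$ for every $k$ (with $CS[1]=[1]$). An inductive strategy of length $n$ is a strategy $S$ with $S[k]=CS[k]$ for $1\le k\le n-1$ and $S[n]$ an arbitrary cyclic permutation of $[n]$ (a single $n$-cycle). -}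

module Defs where

open import Data.Nat using (ℕ; zero; suc; _<?_)
open import Data.Nat.Properties using () renaming (_≟_ to _≟ℕ_)
open import Data.Fin using (Fin; zero; suc; toℕ; fromℕ<; _≟_)
open import Data.Bool using (Bool; true; false; not; _∧_)
open import Data.List as L using (List; []; _∷_; length; filterᵇ; concatMap; foldl)
open import Data.Vec as V using (Vec; []; _∷_; lookup; _[_]≔_; toList)
open import Data.Vec.Properties using (≡-dec)
open import Data.Product using (∃; _×_)
open import Function using (_∘_; id)
open import Function.Definitions using (Injective)
open import Relation.Nullary using (does)
open import Relation.Binary.PropositionalEquality using (_≡_; refl)
import Data.List.Relation.Unary.Unique.DecPropositional as UD

-- Everything is 0-indexed: [n] = {1,..,n} is modelled by Fin n = {0,..,n-1}.
-- A permutation of [k] (one-line notation) is a function Fin k → Fin k.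

iter : ∀ {k} → (Fin k → Fin k) → ℕ → Fin k → Fin k
iter σ zero    x = x
iter σ (suc j) x = σ (iter σ j x)

IsCyclic : ∀ {k} → (Fin k → Fin k) → Set
IsCyclic {k} σ = Injective _≡_ _≡_ σ × (∀ x y → ∃ λ j → iter σ j x ≡ y)


-- CS[k] = [2,3,…,k,1], i.e. (0-indexed) i ↦ i+1 for i < k-1 and k-1 ↦ 0.
cs : (k : ℕ) → Fin k → Fin k
cs (suc k) i with suc (toℕ i) <? suc k
... | Relation.Nullary.yes p = fromℕ< p
... | Relation.Nullary.no  _ = zero

-- A strategy: S[k] is a permutation of [k] for each k (only k ≤ n is ever used).
Strategy : Set
Strategy = (k : ℕ) → Fin k → Fin k

CS : Strategy
CS = cs

inductiveS : (n : ℕ) → (Fin n → Fin n) → Strategy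
inductiveS n σ k with k ≟ℕ n
... | Relation.Nullary.yes refl = σ
... | Relation.Nullary.no  _    = cs k

_==_ : ∀ {n} → Vec (Fin n) n → Vec (Fin n) n → Bool
γ == π = does (≡-dec _≟_ γ π)

-- One step of the game: given the current guess γ and the secret π,
-- I = {i₁ < … < i_k} = mismatched positions, σ = S[k], and
-- γ'(i_{σ(j)}) = γ(i_j), γ' = γ on matched positions.
step : ∀ {n} → Strategy → Vec (Fin n) n → Vec (Fin n) n → Vec (Fin n) n
step {n} S π γ = foldl upd γ (L.allFin k)
  where
  I : List (Fin n)
  I = filterᵇ (λ i → not (does (lookup γ i ≟ lookup π i))) (L.allFin n)
  k : ℕ
  k = length I
  iv : Fin k → Fin n
  iv = lookup (V.fromList I)
  σ : Fin k → Fin k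
  σ = S k
  upd : Vec (Fin n) n → Fin k → Vec (Fin n) n
  upd acc j = acc [ iv (σ j) ]≔ lookup γ (iv j)

-- γ_r for r ≥ 1 (argument r-1): γ_1 = identity, γ_{r+1} = step γ_r.
guess : ∀ {n} → Strategy → Vec (Fin n) n → ℕ → Vec (Fin n) n
guess {n} S π zero    = V.allFin n
guess     S π (suc r) = step S π (guess S π r)

endsAt3 : ∀ {n} → Strategy → Vec (Fin n) n → Bool
endsAt3 S π = not (guess S π 0 == π) ∧ not (guess S π 1 == π) ∧ (guess S π 2 == π)

vecs : (k m : ℕ) → List (Vec (Fin k) m)
vecs k zero    = [] ∷ []
vecs k (suc m) = concatMap (λ x → L.map (x ∷_) (vecs k m)) (L.allFin k)

perms : (n : ℕ) → List (Vec (Fin n) n)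
perms n = filterᵇ (λ v → does (UD.unique? _≟_ (toList v))) (vecs n n)

coeff3 : Strategy → (n : ℕ) → ℕ
coeff3 S n = length (filterᵇ (endsAt3 S) (perms n))

-- A permutation with a fixed point is played identically by S and CS: a correct
-- position stays correct, so fewer than n positions are ever wrong and S[k] = CS[k] is used.
-- For a derangement π the first move applies S[n] = σ, making the second guess σ⁻¹. If that
-- guess already agrees with π somewhere, σ ∘ π is a permutation that CS solves at its second
-- guess, that has a fixed point and agrees with σ nowhere; otherwise π is pinned down by
-- σ ∘ π ∘ σ = id, so there is at most one such π. Dually, cs⁻¹ ∘ τ embeds the permutations τ
-- solved by CS at guess two and agreeing with cs nowhere into the CS-derangements solved at
-- guess three. The permutations solved by CS at guess two are the rotations of their mismatch
-- sets; at most n of them agree with cs somewhere (the transpositions (x cs x)), at least n + 1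
-- have a fixed point and agree with σ somewhere (the transpositions (x σx) and one 3-cycle,
-- which needs σ ≠ cs and n ≥ 4), and the rotation of all of [n] is a derangement. Counting them
-- both ways shows that CS solves more derangements at guess three than S does.
module Submission where

open import Defs
open import Data.Bool using (Bool; true; false; not; _∧_; T; T?)
open import Data.Bool.Properties using (T-∧; ∧-zeroʳ)
open import Data.Empty using (⊥; ⊥-elim)
open import Data.Fin as Fin using (Fin; zero; suc; toℕ; fromℕ; inject₁; _≟_)
  renaming (_<_ to _<ᶠ_; _≤_ to _≤ᶠ_)
import Data.Fin.Properties as Fin
open import Data.List as List using (List; []; _∷_; length; foldl; filterᵇ; _++_; cartesianProductWith; concatMap)
open import Data.List.Properties
  using (length-++; length-map; length-tabulate; foldl-cong; filter-all; filter-notAll; filter-≐)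
open import Data.List.Membership.Propositional using (_∈_; _∉_)
open import Data.List.Membership.Propositional.Properties
  using (∈-filter⁺; ∈-filter⁻; ∈-∃++; ∈-++⁻; ∈-++⁺ˡ; ∈-++⁺ʳ; ∈-map⁺; ∈-map⁻;
         ∈-cartesianProductWith⁺; ∈-allFin; ∈-lookup)
import Data.List.Membership.DecPropositional as DecMembership
open import Data.List.Relation.Unary.All as All using (All)
open import Data.List.Relation.Unary.Any as Any using (here; there)
open import Data.List.Relation.Unary.Any.Properties using (lookup-index)
open import Data.List.Relation.Unary.AllPairs using (AllPairs; []; _∷_)
open import Data.List.Relation.Unary.AllPairs.Properties using (tabulate⁺-<; filter⁺)
open import Data.List.Relation.Unary.Unique.Propositional using (Unique)
import Data.List.Relation.Unary.Unique.Propositional.Properties as Unique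
import Data.List.Relation.Unary.Unique.DecPropositional as UniqueDec
open import Data.Nat as ℕ using (ℕ; zero; suc; _+_; _≤_; _<_; _<?_; z≤n; s≤s)
import Data.Nat.Properties as ℕ
open import Data.Nat.Tactic.RingSolver using (solve-∀)
open import Data.Product using (∃; _×_; _,_; proj₁; proj₂)
open import Data.Sum using (_⊎_; inj₁; inj₂; [_,_]′)
open import Data.Unit using (tt)
open import Data.Vec as Vec using (Vec; []; _∷_; lookup; toList; tabulate; fromList; _[_]≔_)
open import Data.Vec.Properties
  using (∷-injective; tabulate∘lookup; tabulate-cong; toList-map; lookup-map; lookup∘update; lookup∘update′;
         map-[]≔; ≡-dec; lookup-allFin)
open import Function using (id; _∘_; Equivalence)
open import Function.Definitions using (Injective)
open import Relation.Binary.Definitions using (tri<; tri≈; tri>)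
open import Relation.Binary.PropositionalEquality
  using (_≡_; _≢_; refl; sym; trans; cong; cong₂; subst; module ≡-Reasoning)
open import Relation.Nullary using (¬_; Dec; yes; no; does; ¬?; _×-dec_)

module _ {A : Set} where

  T-does⁺ : {a? : Dec A} → A → T (does a?)
  T-does⁺ {yes _} _ = tt
  T-does⁺ {no ¬a} a = ¬a a

  T-does⁻ : {a? : Dec A} → T (does a?) → A
  T-does⁻ {yes a} _ = a

  T-not-does⁺ : {a? : Dec A} → ¬ A → T (not (does a?))
  T-not-does⁺ {yes a} ¬a = ¬a a
  T-not-does⁺ {no _}  _  = tt

  T-not-does⁻ : {a? : Dec A} → T (not (does a?)) → ¬ A
  T-not-does⁻ {no ¬a} _ = ¬a

-- Counting in lists

count : {A : Set} → (A → Bool) → List A → ℕ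
count p xs = length (filterᵇ p xs)

module _ {A : Set} where

  ∈-filterᵇ⁺ : (p : A → Bool) {xs : List A} {x : A} → x ∈ xs → T (p x) → x ∈ filterᵇ p xs
  ∈-filterᵇ⁺ p = ∈-filter⁺ (T? ∘ p)

  ∈-filterᵇ⁻ : (p : A → Bool) {xs : List A} {x : A} → x ∈ filterᵇ p xs → x ∈ xs × T (p x)
  ∈-filterᵇ⁻ p = ∈-filter⁻ (T? ∘ p)

  filterᵇ-unique : (p : A → Bool) {xs : List A} → Unique xs → Unique (filterᵇ p xs)
  filterᵇ-unique p = Unique.filter⁺ (T? ∘ p)

  count-split : (p q : A → Bool) (xs : List A) →
    count p xs ≡ count (λ x → p x ∧ q x) xs + count (λ x → p x ∧ not (q x)) xs
  count-split p q [] = refl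
  count-split p q (x ∷ xs) with p x | q x
  ... | false | _     = count-split p q xs
  ... | true  | true  = cong suc (count-split p q xs)
  ... | true  | false = trans (cong suc (count-split p q xs)) (sym (ℕ.+-suc _ _))

  count-cong : {p q : A → Bool} (xs : List A) → (∀ x → p x ≡ q x) → count p xs ≡ count q xs
  count-cong []       _   = refl
  count-cong {p} {q} (x ∷ xs) p≗q with p x | q x | p≗q x
  ... | false | false | _ = count-cong xs p≗q
  ... | true  | true  | _ = cong suc (count-cong xs p≗q)

  length-≤-of-⊆ : {xs ys : List A} → Unique xs → (∀ {x} → x ∈ xs → x ∈ ys) → length xs ≤ length ys
  length-≤-of-⊆ {[]}     _          _  = z≤n
  length-≤-of-⊆ {x ∷ xs} (x∉ ∷ uxs) xs⊆ys with ∈-∃++ (xs⊆ys (here refl))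
  ... | as , bs , refl = subst (suc (length xs) ≤_) length-as++x∷bs
                           (s≤s (length-≤-of-⊆ uxs xs⊆as++bs))
    where
    xs⊆as++bs : ∀ {y} → y ∈ xs → y ∈ as ++ bs
    xs⊆as++bs y∈xs with ∈-++⁻ as (xs⊆ys (there y∈xs))
    ... | inj₁ y∈as         = ∈-++⁺ˡ y∈as
    ... | inj₂ (here refl)  = ⊥-elim (All.lookup x∉ y∈xs refl)
    ... | inj₂ (there y∈bs) = ∈-++⁺ʳ as y∈bs
    length-as++x∷bs : suc (length (as ++ bs)) ≡ length (as ++ x ∷ bs)
    length-as++x∷bs rewrite length-++ as {bs} | length-++ as {x ∷ bs} = sym (ℕ.+-suc _ _)

  length-≤-count : (q : A → Bool) {ws ys : List A} → Unique ws →
    (∀ {w} → w ∈ ws → w ∈ ys × T (q w)) → length ws ≤ count q ys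
  length-≤-count q uws h = length-≤-of-⊆ uws (λ w∈ws → let w∈ys , qw = h w∈ws in ∈-filterᵇ⁺ q w∈ys qw)

  count-≤-length : (p : A → Bool) {xs cs : List A} → Unique xs →
    (∀ {x} → x ∈ xs → T (p x) → x ∈ cs) → count p xs ≤ length cs
  count-≤-length p {xs} uxs h = length-≤-of-⊆ (filterᵇ-unique p uxs)
    (λ x∈ → let x∈xs , px = ∈-filterᵇ⁻ p {xs} x∈ in h x∈xs px)

  count-≤-1 : (p : A → Bool) {xs : List A} → Unique xs →
    (∀ {x y} → T (p x) → T (p y) → x ≡ y) → count p xs ≤ 1
  count-≤-1 p {xs} uxs p-unique with filterᵇ p xs in eq | filterᵇ-unique p uxs
  ... | []         | _        = z≤n
  ... | x ∷ []     | _        = s≤s z≤n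
  ... | x ∷ y ∷ zs | (x∉ ∷ _) =
    ⊥-elim (All.lookup x∉ (here refl) (p-unique (satisfies x (here refl)) (satisfies y (there (here refl)))))
    where
    satisfies : ∀ z → z ∈ x ∷ y ∷ zs → T (p z)
    satisfies z z∈ = proj₂ (∈-filterᵇ⁻ p {xs} (subst (z ∈_) (sym eq) z∈))

module _ {A B : Set} where

  count-≤-injection : {f : A → B} → Injective _≡_ _≡_ f → (p : A → Bool) (q : B → Bool) →
    {xs : List A} {ys : List B} → Unique xs →
    (∀ {x} → x ∈ xs → T (p x) → f x ∈ ys × T (q (f x))) → count p xs ≤ count q ys
  count-≤-injection {f} f-inj p q {xs} {ys} uxs maps-to =
    subst (_≤ count q ys) (length-map f (filterᵇ p xs))
      (length-≤-count q (Unique.map⁺ f-inj (filterᵇ-unique p uxs)) image⊆)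
    where
    image⊆ : ∀ {z} → z ∈ List.map f (filterᵇ p xs) → z ∈ ys × T (q z)
    image⊆ z∈ with ∈-map⁻ f z∈
    ... | x , x∈ , refl = let x∈xs , px = ∈-filterᵇ⁻ p {xs} x∈ in maps-to x∈xs px

-- Vectors and the enumeration of permutations

lookup-ext : {A : Set} {n : ℕ} {xs ys : Vec A n} → (∀ i → lookup xs i ≡ lookup ys i) → xs ≡ ys
lookup-ext {xs = xs} {ys} eq = trans (sym (tabulate∘lookup xs)) (trans (tabulate-cong eq) (tabulate∘lookup ys))

map-injective : {n : ℕ} {A B : Set} {g : A → B} → Injective _≡_ _≡_ g → Injective _≡_ _≡_ (Vec.map {n = n} g)
map-injective {g = g} g-inj {xs} {ys} eq =
  lookup-ext (λ i → g-inj (trans (sym (lookup-map i g xs)) (trans (cong (λ v → lookup v i) eq) (lookup-map i g ys))))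

toList-tabulate : {A : Set} {n : ℕ} (f : Fin n → A) → toList (tabulate f) ≡ List.tabulate f
toList-tabulate {n = zero}  f = refl
toList-tabulate {n = suc n} f = cong (f zero ∷_) (toList-tabulate (f ∘ suc))

vecs-suc : ∀ k m → vecs k (suc m) ≡ cartesianProductWith _∷_ (List.allFin k) (vecs k m)
vecs-suc k m = concatMap≡cartesianProductWith (List.allFin k)
  where
  concatMap≡cartesianProductWith : ∀ xs →
    concatMap (λ x → List.map (x ∷_) (vecs k m)) xs ≡ cartesianProductWith _∷_ xs (vecs k m)
  concatMap≡cartesianProductWith []       = refl
  concatMap≡cartesianProductWith (x ∷ xs) =
    cong (List.map (x ∷_) (vecs k m) ++_) (concatMap≡cartesianProductWith xs)

∈-vecs : ∀ {k m} (v : Vec (Fin k) m) → v ∈ vecs k m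
∈-vecs             []       = here refl
∈-vecs {k} {suc m} (x ∷ v) rewrite vecs-suc k m = ∈-cartesianProductWith⁺ _∷_ (∈-allFin x) (∈-vecs v)

vecs-unique : ∀ k m → Unique (vecs k m)
vecs-unique k zero    = All.[] ∷ []
vecs-unique k (suc m) rewrite vecs-suc k m =
  Unique.cartesianProductWith⁺ _∷_ ∷-injective (Unique.allFin⁺ k) (vecs-unique k m)

module _ {n : ℕ} where

  perms-unique : Unique (perms n)
  perms-unique = filterᵇ-unique _ (vecs-unique n n)

  ∈-perms⁺ : {v : Vec (Fin n) n} → Unique (toList v) → v ∈ perms n
  ∈-perms⁺ {v} u = ∈-filterᵇ⁺ _ (∈-vecs v) (T-does⁺ {a? = UniqueDec.unique? _≟_ (toList v)} u)

  ∈-perms⁻ : {v : Vec (Fin n) n} → v ∈ perms n → Unique (toList v)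
  ∈-perms⁻ {v} v∈ = T-does⁻ {a? = UniqueDec.unique? _≟_ (toList v)} (proj₂ (∈-filterᵇ⁻ _ {vecs n n} v∈))

  lookup-injective⇒∈-perms : {v : Vec (Fin n) n} → Injective _≡_ _≡_ (lookup v) → v ∈ perms n
  lookup-injective⇒∈-perms {v} inj =
    ∈-perms⁺ (subst (Unique ∘ toList) (tabulate∘lookup v)
      (subst Unique (sym (toList-tabulate (lookup v))) (Unique.tabulate⁺ inj)))

  map-∈-perms : {g : Fin n → Fin n} → Injective _≡_ _≡_ g → {v : Vec (Fin n) n} →
    v ∈ perms n → Vec.map g v ∈ perms n
  map-∈-perms {g} g-inj {v} v∈ =
    ∈-perms⁺ (subst Unique (sym (toList-map g v)) (Unique.map⁺ g-inj (∈-perms⁻ v∈)))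

-- Sorted lists of positions and a single move of the game

Sorted : {n : ℕ} → List (Fin n) → Set
Sorted = AllPairs _<ᶠ_

lookup-fromList : {A : Set} (xs : List A) (i : Fin (length xs)) → lookup (fromList xs) i ≡ List.lookup xs i
lookup-fromList (x ∷ xs) zero    = refl
lookup-fromList (x ∷ xs) (suc i) = lookup-fromList xs i

module _ {n : ℕ} where

  lookup-strictMono : {I : List (Fin n)} → Sorted I → {i j : Fin (length I)} →
    i <ᶠ j → List.lookup I i <ᶠ List.lookup I j
  lookup-strictMono {x ∷ I} (x< ∷ _)  {zero}  {suc j} _         = All.lookup x< (∈-lookup j)
  lookup-strictMono {x ∷ I} (_ ∷ I-s) {suc i} {suc j} (s≤s i<j) = lookup-strictMono I-s i<j

  lookup-injective : {I : List (Fin n)} → Sorted I → Injective _≡_ _≡_ (List.lookup I)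
  lookup-injective I-s {i} {j} eq with Fin.<-cmp i j
  ... | tri< i<j _ _ = ⊥-elim (Fin.<⇒≢ (lookup-strictMono I-s i<j) eq)
  ... | tri≈ _ i≡j _ = i≡j
  ... | tri> _ _ j<i = ⊥-elim (Fin.<⇒≢ (lookup-strictMono I-s j<i) (sym eq))

module _ {n : ℕ} {I : List (Fin n)} (I-s : Sorted I) where

  lookup-monotone : ∀ {i j} → i ≤ᶠ j → List.lookup I i ≤ᶠ List.lookup I j
  lookup-monotone {i} {j} i≤j with Fin.<-cmp i j
  ... | tri< i<j _ _ = ℕ.<⇒≤ (lookup-strictMono I-s i<j)
  ... | tri≈ _ refl _ = ℕ.≤-refl
  ... | tri> _ _ j<i = ⊥-elim (ℕ.<⇒≱ j<i i≤j)

  lookup-reflects-< : ∀ {i j} → List.lookup I i <ᶠ List.lookup I j → i <ᶠ j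
  lookup-reflects-< {i} {j} fi<fj with Fin.<-cmp i j
  ... | tri< i<j _ _ = i<j
  ... | tri≈ _ refl _ = ⊥-elim (Fin.<-irrefl refl fi<fj)
  ... | tri> _ _ j<i = ⊥-elim (Fin.<-asym fi<fj (lookup-strictMono I-s j<i))

sorted-≡ : {n : ℕ} {xs ys : List (Fin n)} → Sorted xs → Sorted ys →
  (∀ {z} → z ∈ xs → z ∈ ys) → (∀ {z} → z ∈ ys → z ∈ xs) → xs ≡ ys
sorted-≡ {xs = []}     {[]}     _ _ _ _ = refl
sorted-≡ {xs = []}     {y ∷ _}  _ _ _ ys⊆xs with ys⊆xs (here refl)
... | ()
sorted-≡ {xs = x ∷ _}  {[]}     _ _ xs⊆ys _ with xs⊆ys (here refl)
... | ()
sorted-≡ {xs = x ∷ xs} {y ∷ ys} (x< ∷ xs-s) (y< ∷ ys-s) xs⊆ys ys⊆xs with xs⊆ys (here refl) | ys⊆xs (here refl)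
... | there x∈ys | there y∈xs = ⊥-elim (Fin.<-asym (All.lookup y< x∈ys) (All.lookup x< y∈xs))
... | there x∈ys | here refl  = ⊥-elim (Fin.<-irrefl refl (All.lookup y< x∈ys))
... | here refl  | _          = cong (x ∷_) (sorted-≡ xs-s ys-s (tail x< xs⊆ys) (tail y< ys⊆xs))
  where
  tail : ∀ {as bs} → All (x <ᶠ_) as → (∀ {z} → z ∈ x ∷ as → z ∈ x ∷ bs) → ∀ {z} → z ∈ as → z ∈ bs
  tail x<as as⊆ z∈as with as⊆ (there z∈as)
  ... | here refl = ⊥-elim (Fin.<-irrefl refl (All.lookup x<as z∈as))
  ... | there z∈bs = z∈bs

sorted₃ : {n : ℕ} {a b c : Fin n} → a <ᶠ b → b <ᶠ c → Sorted (a ∷ b ∷ c ∷ [])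
sorted₃ a<b b<c = (a<b All.∷ Fin.<-trans a<b b<c All.∷ All.[]) ∷ (b<c All.∷ All.[]) ∷ All.[] ∷ []

module _ {A : Set} {n k : ℕ} (pos : Fin k → Fin n) (val : Fin k → A) where

  updateAll : Vec A n → List (Fin k) → Vec A n
  updateAll = foldl (λ acc j → acc [ pos j ]≔ val j)

  lookup-updateAll-∉ : ∀ js acc p → (∀ {j} → j ∈ js → pos j ≢ p) → lookup (updateAll acc js) p ≡ lookup acc p
  lookup-updateAll-∉ []       acc p _      = refl
  lookup-updateAll-∉ (j ∷ js) acc p p-free =
    trans (lookup-updateAll-∉ js _ p (p-free ∘ there)) (lookup∘update′ (p-free (here refl) ∘ sym) acc (val j))

  lookup-updateAll-∈ : Injective _≡_ _≡_ pos → ∀ {js} → Unique js → ∀ acc {j} → j ∈ js →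
    lookup (updateAll acc js) (pos j) ≡ val j
  lookup-updateAll-∈ pos-inj (j∉ ∷ _) acc (here refl) =
    trans (lookup-updateAll-∉ _ _ _ (λ j′∈ eq → All.lookup j∉ j′∈ (pos-inj (sym eq))))
          (lookup∘update (pos _) acc (val _))
  lookup-updateAll-∈ pos-inj (_ ∷ js-u) acc (there j∈) = lookup-updateAll-∈ pos-inj js-u _ j∈

  updateAll-map : {B : Set} (g : A → B) → ∀ acc js →
    Vec.map g (updateAll acc js) ≡ foldl (λ acc j → acc [ pos j ]≔ g (val j)) (Vec.map g acc) js
  updateAll-map g acc []       = refl
  updateAll-map g acc (j ∷ js) = trans (updateAll-map g _ js) (cong (λ v → foldl _ v js) (map-[]≔ g acc (pos j)))

universal⇒n≤length : {n : ℕ} {xs : List (Fin n)} → (∀ p → p ∈ xs) → n ≤ length xs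
universal⇒n≤length {n} {xs} all∈ =
  subst (_≤ length xs) (length-tabulate id) (length-≤-of-⊆ (Unique.allFin⁺ n) (λ {p} _ → all∈ p))

lookup-tabulate-cast : {A : Set} {n : ℕ} (f : Fin n → A) (j : Fin (length (List.tabulate f))) →
  List.lookup (List.tabulate f) j ≡ f (Fin.cast (length-tabulate f) j)
lookup-tabulate-cast {n = suc n} f zero    = refl
lookup-tabulate-cast {n = suc n} f (suc j) = lookup-tabulate-cast (f ∘ suc) j

module _ {n : ℕ} where

  mismatches : Vec (Fin n) n → Vec (Fin n) n → List (Fin n)
  mismatches γ π = filterᵇ (λ i → not (does (lookup γ i ≟ lookup π i))) (List.allFin n)

  -- step S π γ unfolds definitionally to rearrange γ (mismatches γ π) (S k), k = length (mismatches γ π).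
  rearrange : Vec (Fin n) n → (I : List (Fin n)) → (Fin (length I) → Fin (length I)) → Vec (Fin n) n
  rearrange γ I s = updateAll (lookup (fromList I) ∘ s) (lookup γ ∘ lookup (fromList I)) γ (List.allFin (length I))

  mismatches-sorted : ∀ γ π → Sorted (mismatches γ π)
  mismatches-sorted γ π = filter⁺ _ (tabulate⁺-< (λ i<j → i<j))

  ∈-mismatches⁺ : ∀ {γ π p} → lookup γ p ≢ lookup π p → p ∈ mismatches γ π
  ∈-mismatches⁺ {γ} {π} {p} γp≢πp = ∈-filterᵇ⁺ (λ i → not (does (lookup γ i ≟ lookup π i))) (∈-allFin p)
    (T-not-does⁺ {a? = lookup γ p ≟ lookup π p} γp≢πp)

  ∈-mismatches⁻ : ∀ {γ π p} → p ∈ mismatches γ π → lookup γ p ≢ lookup π p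
  ∈-mismatches⁻ {γ} {π} {p} p∈ =
    T-not-does⁻ {a? = lookup γ p ≟ lookup π p} (proj₂ (∈-filterᵇ⁻ _ {List.allFin n} p∈))

  mismatches-allFin : ∀ {γ π} → (∀ p → lookup γ p ≢ lookup π p) → mismatches γ π ≡ List.allFin n
  mismatches-allFin {γ} {π} everywhere =
    filter-all _ (All.universal (λ p → T-not-does⁺ {a? = lookup γ p ≟ lookup π p} (everywhere p)) _)

  length-mismatches-< : ∀ {γ π p} → lookup γ p ≡ lookup π p → length (mismatches γ π) < n
  length-mismatches-< {γ} {π} {p} γp≡πp = subst (length (mismatches γ π) <_) (length-tabulate id)
    (filter-notAll _ (List.allFin n) (Any.map matched (∈-allFin p)))
    where
    matched : ∀ {q} → p ≡ q → ¬ T (not (does (lookup γ q ≟ lookup π q)))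
    matched refl mismatch = T-not-does⁻ {a? = lookup γ p ≟ lookup π p} mismatch γp≡πp

  rearrange-∉ : ∀ γ I s {p} → p ∉ I → lookup (rearrange γ I s) p ≡ lookup γ p
  rearrange-∉ γ I s p∉I = lookup-updateAll-∉ _ _ (List.allFin (length I)) γ _
    (λ {j} _ eq → p∉I (subst (_∈ I) (trans (sym (lookup-fromList I (s j))) eq) (∈-lookup (s j))))

  rearrange-∈ : ∀ γ {I} → Sorted I → ∀ {s} → Injective _≡_ _≡_ s → ∀ j →
    lookup (rearrange γ I s) (List.lookup I (s j)) ≡ lookup γ (List.lookup I j)
  rearrange-∈ γ {I} I-s {s} s-inj j = begin
    lookup (rearrange γ I s) (List.lookup I (s j))    ≡⟨ cong (lookup (rearrange γ I s)) (sym (lookup-fromList I (s j))) ⟩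
    lookup (rearrange γ I s) (lookup (fromList I) (s j))
      ≡⟨ lookup-updateAll-∈ _ _ position-injective (Unique.allFin⁺ _) γ (∈-allFin j) ⟩
    lookup γ (lookup (fromList I) j)                  ≡⟨ cong (lookup γ) (lookup-fromList I j) ⟩
    lookup γ (List.lookup I j)                        ∎
    where
    open ≡-Reasoning
    position-injective : Injective _≡_ _≡_ (lookup (fromList I) ∘ s)
    position-injective {i} {j} eq =
      s-inj (lookup-injective I-s (trans (sym (lookup-fromList I (s i))) (trans eq (lookup-fromList I (s j)))))

  rearrange-cong : ∀ γ I {s s′} → (∀ j → s j ≡ s′ j) → rearrange γ I s ≡ rearrange γ I s′
  rearrange-cong γ I s≗s′ =
    foldl-cong (λ acc j → cong (λ i → acc [ lookup (fromList I) i ]≔ _) (s≗s′ j)) γ (List.allFin (length I))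

  rearrange-map : ∀ (g : Fin n → Fin n) γ I s → rearrange (Vec.map g γ) I s ≡ Vec.map g (rearrange γ I s)
  rearrange-map g γ I s = trans
    (foldl-cong (λ acc j → cong (acc [ lookup (fromList I) (s j) ]≔_) (lookup-map (lookup (fromList I) j) g γ))
                (Vec.map g γ) (List.allFin (length I)))
    (sym (updateAll-map _ _ g γ (List.allFin (length I))))

  mismatches-map : ∀ {g : Fin n → Fin n} → Injective _≡_ _≡_ g → ∀ γ π →
    mismatches (Vec.map g γ) (Vec.map g π) ≡ mismatches γ π
  mismatches-map {g} g-inj γ π = filter-≐ _ _ (mismatch-⇐ , mismatch-⇒) (List.allFin n)
    where
    gγ : Vec (Fin n) n
    gγ = Vec.map g γ
    gπ : Vec (Fin n) n
    gπ = Vec.map g π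
    match-⇒ : ∀ i → lookup γ i ≡ lookup π i → lookup gγ i ≡ lookup gπ i
    match-⇒ i eq = trans (lookup-map i g γ) (trans (cong g eq) (sym (lookup-map i g π)))
    match-⇐ : ∀ i → lookup gγ i ≡ lookup gπ i → lookup γ i ≡ lookup π i
    match-⇐ i eq = g-inj (trans (sym (lookup-map i g γ)) (trans eq (lookup-map i g π)))
    mismatch-⇐ : ∀ {i} → T (not (does (lookup gγ i ≟ lookup gπ i))) → T (not (does (lookup γ i ≟ lookup π i)))
    mismatch-⇐ {i} t = T-not-does⁺ {a? = lookup γ i ≟ _} (T-not-does⁻ {a? = lookup gγ i ≟ _} t ∘ match-⇒ i)
    mismatch-⇒ : ∀ {i} → T (not (does (lookup γ i ≟ lookup π i))) → T (not (does (lookup gγ i ≟ lookup gπ i)))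
    mismatch-⇒ {i} t = T-not-does⁺ {a? = lookup gγ i ≟ _} (T-not-does⁻ {a? = lookup γ i ≟ _} t ∘ match-⇐ i)

  step-cong : ∀ {S S′ : Strategy} π γ →
    (∀ j → S (length (mismatches γ π)) j ≡ S′ (length (mismatches γ π)) j) → step S π γ ≡ step S′ π γ
  step-cong π γ = rearrange-cong γ (mismatches γ π)

  step-map : ∀ S {g : Fin n → Fin n} → Injective _≡_ _≡_ g → ∀ π γ →
    step S (Vec.map g π) (Vec.map g γ) ≡ Vec.map g (step S π γ)
  step-map S {g} g-inj π γ rewrite mismatches-map g-inj γ π = rearrange-map g γ (mismatches γ π) _

  step-derangement : ∀ (S : Strategy) {g : Fin n → Fin n} → (∀ j → S n j ≡ g j) →
    (∀ k → Injective _≡_ _≡_ (S k)) → ∀ {γ π} → (∀ p → lookup γ p ≢ lookup π p) →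
    ∀ p → lookup (step S π γ) (g p) ≡ lookup γ p
  step-derangement S {g} S≗g S-inj {γ} {π} everywhere p rewrite mismatches-allFin {γ} {π} everywhere = begin
    lookup τ (g p)                             ≡⟨ cong (lookup τ ∘ g) p≡ ⟩
    lookup τ (g (List.lookup allFin j))        ≡⟨ cong (lookup τ) (sym (S-allFin j)) ⟩
    lookup τ (List.lookup allFin (S _ j))      ≡⟨ rearrange-∈ γ (tabulate⁺-< (λ i<j → i<j)) (S-inj _) j ⟩
    lookup γ (List.lookup allFin j)            ≡⟨ cong (lookup γ) (sym p≡) ⟩
    lookup γ p                                 ∎
    where
    open ≡-Reasoning
    allFin : List (Fin n)
    allFin = List.allFin n
    τ : Vec (Fin n) n
    τ = rearrange γ allFin (S (length allFin))
    j : Fin (length allFin)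
    j = Any.index (∈-allFin p)
    p≡ : p ≡ List.lookup allFin j
    p≡ = lookup-index (∈-allFin p)
    -- length (List.allFin n) ≡ n holds only propositionally, so S is reached through a cast.
    S-cast : ∀ {k} (e : k ≡ n) (i : Fin k) → Fin.cast e (S k i) ≡ g (Fin.cast e i)
    S-cast refl i = trans (Fin.cast-is-id refl _) (trans (S≗g i) (cong g (sym (Fin.cast-is-id refl i))))
    S-allFin : ∀ i → List.lookup allFin (S _ i) ≡ g (List.lookup allFin i)
    S-allFin i = trans (lookup-tabulate-cast id (S _ i))
      (trans (S-cast (length-tabulate id) i) (cong g (sym (lookup-tabulate-cast id i))))

-- Cyclic shifts, inductive strategies and cyclic permutations

toℕ-cs : ∀ k (i : Fin k) →
  (ℕ.suc (toℕ i) < k × toℕ (cs k i) ≡ ℕ.suc (toℕ i)) ⊎ (ℕ.suc (toℕ i) ≡ k × toℕ (cs k i) ≡ 0)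
toℕ-cs (ℕ.suc k) i with ℕ.suc (toℕ i) <? ℕ.suc k
... | yes i+1<k = inj₁ (i+1<k , Fin.toℕ-fromℕ< i+1<k)
... | no  i+1≮k = inj₂ (ℕ.≤-antisym (Fin.toℕ<n i) (ℕ.≮⇒≥ i+1≮k) , refl)

cs⁻¹ : ∀ k → Fin k → Fin k
cs⁻¹ (ℕ.suc k) zero    = fromℕ k
cs⁻¹ (ℕ.suc k) (suc i) = inject₁ i

cs-injective : ∀ k → Injective _≡_ _≡_ (cs k)
cs-injective k {i} {j} eq with toℕ-cs k i | toℕ-cs k j
... | inj₁ (_ , ci) | inj₁ (_ , cj) = Fin.toℕ-injective (ℕ.suc-injective (trans (sym ci) (trans (cong toℕ eq) cj)))
... | inj₁ (_ , ci) | inj₂ (_ , cj) = ⊥-elim (ℕ.0≢1+n (trans (sym cj) (trans (sym (cong toℕ eq)) ci)))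
... | inj₂ (_ , ci) | inj₁ (_ , cj) = ⊥-elim (ℕ.0≢1+n (trans (sym ci) (trans (cong toℕ eq) cj)))
... | inj₂ (i+1≡k , _) | inj₂ (j+1≡k , _) = Fin.toℕ-injective (ℕ.suc-injective (trans i+1≡k (sym j+1≡k)))

cs-cs⁻¹ : ∀ k (j : Fin k) → cs k (cs⁻¹ k j) ≡ j
cs-cs⁻¹ k j with toℕ-cs k (cs⁻¹ k j)
cs-cs⁻¹ (ℕ.suc k) zero    | inj₁ (last+1<k , _) = ⊥-elim (ℕ.<-irrefl (cong ℕ.suc (Fin.toℕ-fromℕ k)) last+1<k)
cs-cs⁻¹ (ℕ.suc k) zero    | inj₂ (_ , c)        = Fin.toℕ-injective c
cs-cs⁻¹ (ℕ.suc k) (suc i) | inj₁ (_ , c)        = Fin.toℕ-injective (trans c (cong ℕ.suc (Fin.toℕ-inject₁ i)))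
cs-cs⁻¹ (ℕ.suc k) (suc i) | inj₂ (i+1≡k , _)    =
  ⊥-elim (ℕ.<-irrefl (trans (cong ℕ.suc (sym (Fin.toℕ-inject₁ i))) i+1≡k) (s≤s (Fin.toℕ<n i)))

cs⁻¹-injective : ∀ k → Injective _≡_ _≡_ (cs⁻¹ k)
cs⁻¹-injective k {i} {j} eq = trans (sym (cs-cs⁻¹ k i)) (trans (cong (cs k) eq) (cs-cs⁻¹ k j))

cs-≢ : ∀ {k} → 2 ≤ k → ∀ (i : Fin k) → cs k i ≢ i
cs-≢ {k} 2≤k i eq with toℕ-cs k i
... | inj₁ (_ , c)       = ℕ.1+n≢n (trans (sym c) (cong toℕ eq))
... | inj₂ (i+1≡k , c) = ℕ.<-irrefl (trans (cong suc (trans (sym c) (cong toℕ eq))) i+1≡k) 2≤k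

module _ {n : ℕ} (σ : Fin n → Fin n) where

  inductiveS-≢ : ∀ {k} → k ≢ n → ∀ j → inductiveS n σ k j ≡ cs k j
  inductiveS-≢ {k} k≢n j with k ℕ.≟ n
  ... | yes k≡n = ⊥-elim (k≢n k≡n)
  ... | no  _   = refl

  inductiveS-n : ∀ j → inductiveS n σ n j ≡ σ j
  inductiveS-n j with n ℕ.≟ n
  ... | yes refl = refl
  ... | no  n≢n  = ⊥-elim (n≢n refl)

  inductiveS-injective : Injective _≡_ _≡_ σ → ∀ k → Injective _≡_ _≡_ (inductiveS n σ k)
  inductiveS-injective σ-inj k with k ℕ.≟ n
  ... | yes refl = σ-inj
  ... | no  _    = cs-injective k

module _ {n : ℕ} {σ : Fin n → Fin n} (σ-cyclic : IsCyclic σ) where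

  cyclic-injective : Injective _≡_ _≡_ σ
  cyclic-injective = proj₁ σ-cyclic

  cyclic-surjective : ∀ y → ∃ λ x → σ x ≡ y
  cyclic-surjective y with proj₂ σ-cyclic (σ y) y
  ... | 0       , σy≡y = y , σy≡y
  ... | ℕ.suc j , eq   = iter σ j (σ y) , eq

  cyclic-invariant-length : ∀ {x xs} → x ∈ xs → (∀ {y} → y ∈ xs → σ y ∈ xs) → n ≤ length xs
  cyclic-invariant-length {x} {xs} x∈ closed = universal⇒n≤length all∈
    where
    orbit∈ : ∀ j → iter σ j x ∈ xs
    orbit∈ 0         = x∈
    orbit∈ (ℕ.suc j) = closed (orbit∈ j)
    all∈ : ∀ y → y ∈ xs
    all∈ y = let j , eq = proj₂ σ-cyclic x y in subst (_∈ xs) eq (orbit∈ j)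

  cyclic-≢ : 2 ≤ n → ∀ x → σ x ≢ x
  cyclic-≢ 2≤n x σx≡x =
    ℕ.<⇒≱ 2≤n (cyclic-invariant-length {xs = x ∷ []} (here refl) λ { (here refl) → here σx≡x })

  cyclic-≢² : 3 ≤ n → ∀ x → σ (σ x) ≢ x
  cyclic-≢² 3≤n x σσx≡x = ℕ.<⇒≱ 3≤n (cyclic-invariant-length {xs = x ∷ σ x ∷ []} (here refl) λ
    { (here refl) → there (here refl) ; (there (here refl)) → here σσx≡x })

-- Fixed points and derangements

module _ {n : ℕ} where

  ι : Vec (Fin n) n
  ι = Vec.allFin n

  _≟ᵥ_ : (γ π : Vec (Fin n) n) → Dec (γ ≡ π)
  _≟ᵥ_ = ≡-dec _≟_

  meets : (Fin n → Fin n) → Vec (Fin n) n → Bool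
  meets g τ = does (Fin.any? λ p → lookup τ p ≟ g p)

  meets⁺ : ∀ g τ p → lookup τ p ≡ g p → T (meets g τ)
  meets⁺ g τ p eq = T-does⁺ {a? = Fin.any? λ p → lookup τ p ≟ g p} (p , eq)

  meets⁻ : ∀ g τ → T (meets g τ) → ∃ λ p → lookup τ p ≡ g p
  meets⁻ g τ = T-does⁻ {a? = Fin.any? λ p → lookup τ p ≟ g p}

  avoids : (Fin n → Fin n) → Vec (Fin n) n → Bool
  avoids g τ = not (meets g τ)

  avoids⁺ : ∀ g τ → (∀ p → lookup τ p ≢ g p) → T (avoids g τ)
  avoids⁺ g τ avoiding = T-not-does⁺ {a? = Fin.any? λ p → lookup τ p ≟ g p} λ (p , eq) → avoiding p eq

  avoids⁻ : ∀ g τ → T (avoids g τ) → ∀ p → lookup τ p ≢ g p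
  avoids⁻ g τ t p eq = T-not-does⁻ {a? = Fin.any? λ p → lookup τ p ≟ g p} t (p , eq)

  hasFixedPoint : Vec (Fin n) n → Bool
  hasFixedPoint π = meets id π

  solvedInTwo : Vec (Fin n) n → Bool
  solvedInTwo τ = does (¬? (ι ≟ᵥ τ) ×-dec (step CS τ ι ≟ᵥ τ))

  solvedInTwoFixed : Vec (Fin n) n → Bool
  solvedInTwoFixed τ = solvedInTwo τ ∧ hasFixedPoint τ

  solvedInTwo⁺ : ∀ {τ} → ι ≢ τ → step CS τ ι ≡ τ → T (solvedInTwo τ)
  solvedInTwo⁺ {τ} ι≢τ solved = T-does⁺ {a? = ¬? (ι ≟ᵥ τ) ×-dec (step CS τ ι ≟ᵥ τ)} (ι≢τ , solved)

  solvedInTwo⁻ : ∀ {τ} → T (solvedInTwo τ) → ι ≢ τ × step CS τ ι ≡ τ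
  solvedInTwo⁻ {τ} = T-does⁻ {a? = ¬? (ι ≟ᵥ τ) ×-dec (step CS τ ι ≟ᵥ τ)}

  endsAt3⁺ : ∀ {S} {π : Vec (Fin n) n} → ι ≢ π → guess S π 1 ≢ π → guess S π 2 ≡ π → T (endsAt3 S π)
  endsAt3⁺ {S} {π} ι≢π γ₂≢π γ₃≡π = Equivalence.from T-∧
    (T-not-does⁺ {a? = ι ≟ᵥ π} ι≢π , Equivalence.from T-∧
      (T-not-does⁺ {a? = guess S π 1 ≟ᵥ π} γ₂≢π , T-does⁺ {a? = guess S π 2 ≟ᵥ π} γ₃≡π))

  endsAt3⁻ : ∀ {S} {π : Vec (Fin n) n} → T (endsAt3 S π) →
    ι ≢ π × guess S π 1 ≢ π × guess S π 2 ≡ π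
  endsAt3⁻ {S} {π} t with Equivalence.to T-∧ t
  ... | ι≢π , rest with Equivalence.to T-∧ rest
  ...   | γ₂≢π , γ₃≡π = T-not-does⁻ {a? = ι ≟ᵥ π} ι≢π
                     , T-not-does⁻ {a? = guess S π 1 ≟ᵥ π} γ₂≢π
                     , T-does⁻ {a? = guess S π 2 ≟ᵥ π} γ₃≡π

  derangedEndsAt3 : Strategy → Vec (Fin n) n → Bool
  derangedEndsAt3 S π = endsAt3 S π ∧ not (hasFixedPoint π)

  step-keeps-match : ∀ S {π γ : Vec (Fin n) n} {p} → lookup γ p ≡ lookup π p →
    lookup (step S π γ) p ≡ lookup π p
  step-keeps-match S {π} {γ} γp≡πp =
    trans (rearrange-∉ γ (mismatches γ π) _ (λ p∈ → ∈-mismatches⁻ {γ = γ} {π = π} p∈ γp≡πp)) γp≡πp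

  guess-keeps-fixedPoint : ∀ S {π : Vec (Fin n) n} {p} → lookup π p ≡ p →
    ∀ r → lookup (guess S π r) p ≡ lookup π p
  guess-keeps-fixedPoint S {p = p} πp≡p 0         = trans (lookup-allFin p) (sym πp≡p)
  guess-keeps-fixedPoint S {π}     πp≡p (ℕ.suc r) = step-keeps-match S {π} (guess-keeps-fixedPoint S πp≡p r)

  module _ (σ : Fin n → Fin n) where

    step-inductiveS-match : ∀ {π γ : Vec (Fin n) n} {p} → lookup γ p ≡ lookup π p →
      step (inductiveS n σ) π γ ≡ step CS π γ
    step-inductiveS-match {π} {γ} γp≡πp = step-cong {S = inductiveS n σ} {S′ = CS} π γ
      (inductiveS-≢ σ (ℕ.<⇒≢ (length-mismatches-< {γ = γ} {π = π} γp≡πp)))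

    guess-inductiveS-fixedPoint : ∀ {π : Vec (Fin n) n} {p} → lookup π p ≡ p →
      ∀ r → guess (inductiveS n σ) π r ≡ guess CS π r
    guess-inductiveS-fixedPoint πp≡p 0         = refl
    guess-inductiveS-fixedPoint {π} πp≡p (ℕ.suc r) =
      trans (cong (step (inductiveS n σ) π) (guess-inductiveS-fixedPoint πp≡p r))
            (step-inductiveS-match {π} (guess-keeps-fixedPoint CS {π} πp≡p r))

    endsAt3-inductiveS-fixedPoint : ∀ {π} → T (hasFixedPoint π) → endsAt3 (inductiveS n σ) π ≡ endsAt3 CS π
    endsAt3-inductiveS-fixedPoint {π} fixed with meets⁻ id π fixed
    ... | p , πp≡p = cong₂ (λ (γ₂ γ₃ : Vec (Fin n) n) → not (ι == π) ∧ not (γ₂ == π) ∧ (γ₃ == π))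
                       (guess-inductiveS-fixedPoint {π} πp≡p 1) (guess-inductiveS-fixedPoint {π} πp≡p 2)

    endsAt3-inductiveS-∧-fixedPoint : ∀ π →
      endsAt3 (inductiveS n σ) π ∧ hasFixedPoint π ≡ endsAt3 CS π ∧ hasFixedPoint π
    endsAt3-inductiveS-∧-fixedPoint π with hasFixedPoint π in fixed
    ... | true  = cong (_∧ true) (endsAt3-inductiveS-fixedPoint (subst T (sym fixed) _))
    ... | false = trans (∧-zeroʳ _) (sym (∧-zeroʳ _))

  map-second-guess-derangement : ∀ (S : Strategy) {g} → (∀ j → S n j ≡ g j) →
    (∀ k → Injective _≡_ _≡_ (S k)) → (∀ y → ∃ λ x → g x ≡ y) →
    ∀ {π : Vec (Fin n) n} → (∀ p → lookup π p ≢ p) → Vec.map g (guess S π 1) ≡ ι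
  map-second-guess-derangement S {g} S≗g S-inj g-surj {π} deranged = lookup-ext λ q →
    let p , gp≡q = g-surj q in begin
      lookup (Vec.map g γ₂) q  ≡⟨ lookup-map q g γ₂ ⟩
      g (lookup γ₂ q)          ≡⟨ cong (g ∘ lookup γ₂) (sym gp≡q) ⟩
      g (lookup γ₂ (g p))      ≡⟨ cong g (step-derangement S S≗g S-inj {γ = ι} {π = π} ι≢π p) ⟩
      g (lookup ι p)           ≡⟨ cong g (lookup-allFin p) ⟩
      g p                      ≡⟨ gp≡q ⟩
      q                        ≡⟨ lookup-allFin q ⟨
      lookup ι q               ∎
    where
    open ≡-Reasoning
    γ₂ : Vec (Fin n) n
    γ₂ = step S π ι
    ι≢π : ∀ p → lookup ι p ≢ lookup π p
    ι≢π p eq = deranged p (sym (trans (sym (lookup-allFin p)) eq))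

  module _ {σ : Fin n → Fin n} (σ-cyclic : IsCyclic σ) where

    private
      S : Strategy
      S = inductiveS n σ
      σ-injective : Injective _≡_ _≡_ σ
      σ-injective = cyclic-injective σ-cyclic
      S-injective : ∀ k → Injective _≡_ _≡_ (S k)
      S-injective = inductiveS-injective σ σ-injective

      map-second-guess : ∀ π → T (not (hasFixedPoint π)) → Vec.map σ (guess S π 1) ≡ ι
      map-second-guess π t = map-second-guess-derangement S (inductiveS-n σ) S-injective
        (cyclic-surjective σ-cyclic) {π} (avoids⁻ id π t)

    map-derangedEndsAt3-meeting : ∀ π → T (derangedEndsAt3 S π) → T (meets (lookup π) (guess S π 1)) →
      T (solvedInTwoFixed (Vec.map σ π) ∧ avoids σ (Vec.map σ π))
    map-derangedEndsAt3-meeting π t γ₂-meets-π with Equivalence.to T-∧ t | meets⁻ (lookup π) (guess S π 1) γ₂-meets-π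
    ... | ends , no-fixed | p , γ₂p≡πp with endsAt3⁻ {S} {π} ends
    ...   | _ , γ₂≢π , γ₃≡π = Equivalence.from T-∧ (Equivalence.from T-∧ (solved , fixed) , avoiding)
      where
      open ≡-Reasoning
      τ : Vec (Fin n) n
      τ = Vec.map σ π
      γ₂ : Vec (Fin n) n
      γ₂ = guess S π 1
      σγ₂≡ι : Vec.map σ γ₂ ≡ ι
      σγ₂≡ι = map-second-guess π no-fixed
      solved : T (solvedInTwo τ)
      solved = solvedInTwo⁺ (λ ι≡τ → γ₂≢π (map-injective σ-injective (trans σγ₂≡ι ι≡τ))) (begin
        step CS τ ι               ≡⟨ cong (step CS τ) σγ₂≡ι ⟨
        step CS τ (Vec.map σ γ₂)  ≡⟨ step-map CS σ-injective π γ₂ ⟩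
        Vec.map σ (step CS π γ₂)  ≡⟨ cong (Vec.map σ) (step-inductiveS-match σ {π} {γ₂} γ₂p≡πp) ⟨
        Vec.map σ (step S π γ₂)   ≡⟨ cong (Vec.map σ) γ₃≡π ⟩
        τ                         ∎)
      fixed : T (hasFixedPoint τ)
      fixed = meets⁺ id τ p (begin
        lookup τ p                 ≡⟨ lookup-map p σ π ⟩
        σ (lookup π p)             ≡⟨ cong σ γ₂p≡πp ⟨
        σ (lookup γ₂ p)            ≡⟨ lookup-map p σ γ₂ ⟨
        lookup (Vec.map σ γ₂) p    ≡⟨ cong (λ v → lookup v p) σγ₂≡ι ⟩
        lookup ι p                 ≡⟨ lookup-allFin p ⟩
        p                          ∎)
      avoiding : T (avoids σ τ)
      avoiding = avoids⁺ σ τ λ x τx≡σx →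
        avoids⁻ id π no-fixed x (σ-injective (trans (sym (lookup-map x σ π)) τx≡σx))

    derangedEndsAt3-avoiding⇒σπσ≡id : ∀ π → T (derangedEndsAt3 S π) → T (avoids (lookup π) (guess S π 1)) →
      ∀ q → σ (lookup π (σ q)) ≡ q
    derangedEndsAt3-avoiding⇒σπσ≡id π t γ₂-avoids-π q with Equivalence.to T-∧ t
    ... | ends , no-fixed = begin
      σ (lookup π (σ q))                ≡⟨ cong (λ v → σ (lookup v (σ q))) γ₃≡π ⟨
      σ (lookup (step S π γ₂) (σ q))    ≡⟨ cong σ (step-derangement S (inductiveS-n σ) S-injective {γ = γ₂} {π = π}
                                                                    (avoids⁻ (lookup π) γ₂ γ₂-avoids-π) q) ⟩
      σ (lookup γ₂ q)                   ≡⟨ lookup-map q σ γ₂ ⟨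
      lookup (Vec.map σ γ₂) q           ≡⟨ cong (λ v → lookup v q) (map-second-guess π no-fixed) ⟩
      lookup ι q                        ≡⟨ lookup-allFin q ⟩
      q                                 ∎
      where
      open ≡-Reasoning
      γ₂ : Vec (Fin n) n
      γ₂ = guess S π 1
      γ₃≡π : step S π γ₂ ≡ π
      γ₃≡π = proj₂ (proj₂ (endsAt3⁻ {S} {π} ends))

    derangedEndsAt3-avoiding-unique : ∀ π π′ →
      T (derangedEndsAt3 S π) → T (avoids (lookup π) (guess S π 1)) →
      T (derangedEndsAt3 S π′) → T (avoids (lookup π′) (guess S π′ 1)) → π ≡ π′
    derangedEndsAt3-avoiding-unique π π′ t a t′ a′ = lookup-ext λ p →
      let q , σq≡p = cyclic-surjective σ-cyclic p
      in subst (λ p → lookup π p ≡ lookup π′ p) σq≡p (σ-injective (trans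
           (derangedEndsAt3-avoiding⇒σπσ≡id π t a q) (sym (derangedEndsAt3-avoiding⇒σπσ≡id π′ t′ a′ q))))

    count-derangedEndsAt3-inductiveS :
      count (derangedEndsAt3 S) (perms n) ≤ count (λ τ → solvedInTwoFixed τ ∧ avoids σ τ) (perms n) + 1
    count-derangedEndsAt3-inductiveS = begin
      count D (perms n)                               ≡⟨ count-split D secondGuessMeets (perms n) ⟩
      count (λ π → D π ∧ secondGuessMeets π) (perms n)
        + count (λ π → D π ∧ not (secondGuessMeets π)) (perms n)
        ≤⟨ ℕ.+-mono-≤ (count-≤-injection (map-injective σ-injective) _ _ perms-unique relabelled)
                      (count-≤-1 _ perms-unique determined) ⟩
      count (λ τ → solvedInTwoFixed τ ∧ avoids σ τ) (perms n) + 1  ∎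
      where
      open ℕ.≤-Reasoning
      D : Vec (Fin n) n → Bool
      D = derangedEndsAt3 S
      secondGuessMeets : Vec (Fin n) n → Bool
      secondGuessMeets π = meets (lookup π) (guess S π 1)
      relabelled : ∀ {π} → π ∈ perms n → T (D π ∧ secondGuessMeets π) →
        Vec.map σ π ∈ perms n × T (solvedInTwoFixed (Vec.map σ π) ∧ avoids σ (Vec.map σ π))
      relabelled {π} π∈ t =
        let d , m = Equivalence.to T-∧ t in map-∈-perms σ-injective π∈ , map-derangedEndsAt3-meeting π d m
      determined : ∀ {π π′} → T (D π ∧ not (secondGuessMeets π)) → T (D π′ ∧ not (secondGuessMeets π′)) →
        π ≡ π′
      determined {π} {π′} t t′ = let d , a = Equivalence.to T-∧ t ; d′ , a′ = Equivalence.to T-∧ t′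
                                 in derangedEndsAt3-avoiding-unique π π′ d a d′ a′

  map-cs⁻¹-derangedEndsAt3 : 2 ≤ n → ∀ τ → T (solvedInTwo τ ∧ avoids (cs n) τ) →
    T (derangedEndsAt3 CS (Vec.map (cs⁻¹ n) τ))
  map-cs⁻¹-derangedEndsAt3 2≤n τ t with Equivalence.to T-∧ t
  ... | solved , avoiding with solvedInTwo⁻ solved
  ...   | ι≢τ , solved-step =
    Equivalence.from T-∧ (endsAt3⁺ {CS} {π} ι≢π γ₂≢π γ₃≡π , avoids⁺ id π no-fixed)
    where
    open ≡-Reasoning
    π : Vec (Fin n) n
    π = Vec.map (cs⁻¹ n) τ
    γ₂ : Vec (Fin n) n
    γ₂ = guess CS π 1
    csπ≡τ : Vec.map (cs n) π ≡ τ
    csπ≡τ = lookup-ext λ p →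
      trans (lookup-map p (cs n) π) (trans (cong (cs n) (lookup-map p (cs⁻¹ n) τ)) (cs-cs⁻¹ n _))
    no-fixed : ∀ p → lookup π p ≢ p
    no-fixed p πp≡p = avoids⁻ (cs n) τ avoiding p
      (trans (sym (cs-cs⁻¹ n (lookup τ p))) (cong (cs n) (trans (sym (lookup-map p (cs⁻¹ n) τ)) πp≡p)))
    csγ₂≡ι : Vec.map (cs n) γ₂ ≡ ι
    csγ₂≡ι = map-second-guess-derangement CS (λ _ → refl) cs-injective (λ y → cs⁻¹ n y , cs-cs⁻¹ n y) {π} no-fixed
    ι≢π : ι ≢ π
    ι≢π ι≡π = no-fixed p₀ (sym (trans (sym (lookup-allFin p₀)) (cong (λ v → lookup v p₀) ι≡π)))
      where
      p₀ : Fin n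
      p₀ = Fin.fromℕ< (ℕ.<-≤-trans (s≤s z≤n) 2≤n)
    γ₂≢π : γ₂ ≢ π
    γ₂≢π γ₂≡π = ι≢τ (trans (sym csγ₂≡ι) (trans (cong (Vec.map (cs n)) γ₂≡π) csπ≡τ))
    γ₃≡π : step CS π γ₂ ≡ π
    γ₃≡π = map-injective (cs-injective n) (begin
      Vec.map (cs n) (step CS π γ₂)                   ≡⟨ step-map CS (cs-injective n) π γ₂ ⟨
      step CS (Vec.map (cs n) π) (Vec.map (cs n) γ₂)  ≡⟨ cong₂ (step CS) csπ≡τ csγ₂≡ι ⟩
      step CS τ ι                                     ≡⟨ solved-step ⟩
      τ                                               ≡⟨ csπ≡τ ⟨
      Vec.map (cs n) π                                ∎)

  count-solvedInTwo-avoiding-cs : 2 ≤ n →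
    count (λ τ → solvedInTwo τ ∧ avoids (cs n) τ) (perms n) ≤ count (derangedEndsAt3 CS) (perms n)
  count-solvedInTwo-avoiding-cs 2≤n = count-≤-injection (map-injective (cs⁻¹-injective n)) _ _ perms-unique
    (λ {τ} τ∈ t → map-∈-perms (cs⁻¹-injective n) τ∈ , map-cs⁻¹-derangedEndsAt3 2≤n τ t)

-- Permutations solved at the second guess of CS

module _ {n : ℕ} where

  open DecMembership (_≟_ {n}) using (_∈?_)

  -- CS's second guess when the first one is wrong exactly at the positions in I: each element
  -- of I is sent to its predecessor in I and the least one to the greatest.
  rotation : List (Fin n) → Vec (Fin n) n
  rotation I = rearrange ι I (cs (length I))

  rotation-∉ : ∀ {I p} → p ∉ I → lookup (rotation I) p ≡ p
  rotation-∉ {I} {p} p∉I = trans (rearrange-∉ ι I _ p∉I) (lookup-allFin p)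

  moved⇒∈ : ∀ {I x} → lookup (rotation I) x ≢ x → x ∈ I
  moved⇒∈ {I} {x} moved with x ∈? I
  ... | yes x∈I = x∈I
  ... | no  x∉I = ⊥-elim (moved (rotation-∉ x∉I))

  rotation-lookup : ∀ {I} → Sorted I → ∀ j → lookup (rotation I) (List.lookup I j) ≡ List.lookup I (cs⁻¹ _ j)
  rotation-lookup {I} I-s j = begin
    lookup τ (List.lookup I j)                 ≡⟨ cong (lookup τ ∘ List.lookup I) (cs-cs⁻¹ _ j) ⟨
    lookup τ (List.lookup I (cs _ (cs⁻¹ _ j))) ≡⟨ rearrange-∈ ι I-s (cs-injective _) (cs⁻¹ _ j) ⟩
    lookup ι (List.lookup I (cs⁻¹ _ j))        ≡⟨ lookup-allFin _ ⟩
    List.lookup I (cs⁻¹ _ j)                   ∎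
    where
    open ≡-Reasoning
    τ : Vec (Fin n) n
    τ = rotation I

  rotation-∈ : ∀ {I} → Sorted I → ∀ {p} → p ∈ I → lookup (rotation I) p ∈ I
  rotation-∈ {I} I-s p∈I rewrite lookup-index p∈I = subst (_∈ I) (sym (rotation-lookup I-s _)) (∈-lookup _)

  rotation-moves : ∀ {I} → Sorted I → 2 ≤ length I → ∀ {p} → p ∈ I → lookup (rotation I) p ≢ p
  rotation-moves {I} I-s 2≤|I| p∈I rewrite lookup-index p∈I = λ eq → cs-≢ 2≤|I| (cs⁻¹ _ j)
    (trans (cs-cs⁻¹ _ j) (sym (lookup-injective I-s (trans (sym (rotation-lookup I-s j)) eq))))
    where
    j : Fin (length I)
    j = Any.index p∈I

  rotation-injective : ∀ {I} → Sorted I → Injective _≡_ _≡_ (lookup (rotation I))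
  rotation-injective {I} I-s {p} {q} eq with p ∈? I | q ∈? I
  ... | no p∉  | no q∉  = trans (sym (rotation-∉ p∉)) (trans eq (rotation-∉ q∉))
  ... | yes p∈ | no q∉  = ⊥-elim (q∉ (subst (_∈ I) (trans eq (rotation-∉ q∉)) (rotation-∈ I-s p∈)))
  ... | no p∉  | yes q∈ = ⊥-elim (p∉ (subst (_∈ I) (trans (sym eq) (rotation-∉ p∉)) (rotation-∈ I-s q∈)))
  ... | yes p∈ | yes q∈ rewrite lookup-index p∈ | lookup-index q∈ =
    cong (List.lookup I) (cs⁻¹-injective _ (lookup-injective I-s
      (trans (sym (rotation-lookup I-s _)) (trans eq (rotation-lookup I-s _)))))

  rotation-∈-perms : ∀ {I} → Sorted I → rotation I ∈ perms n
  rotation-∈-perms I-s = lookup-injective⇒∈-perms (rotation-injective I-s)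

  mismatches-rotation : ∀ {I} → Sorted I → 2 ≤ length I → mismatches ι (rotation I) ≡ I
  mismatches-rotation {I} I-s 2≤|I| = sorted-≡ (mismatches-sorted ι (rotation I)) I-s
    (λ {p} p∈ → moved⇒∈ λ τp≡p →
      ∈-mismatches⁻ {γ = ι} {π = rotation I} p∈ (trans (lookup-allFin p) (sym τp≡p)))
    (λ {p} p∈I → ∈-mismatches⁺ {γ = ι} {π = rotation I} λ eq →
      rotation-moves I-s 2≤|I| p∈I (sym (trans (sym (lookup-allFin p)) eq)))

  solvedInTwo-rotation : ∀ {I} → Sorted I → 2 ≤ length I → T (solvedInTwo (rotation I))
  solvedInTwo-rotation {I@(x ∷ _)} I-s 2≤|I| = solvedInTwo⁺
    (λ ι≡τ → rotation-moves I-s 2≤|I| (here refl)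
      (sym (trans (sym (lookup-allFin x)) (cong (λ v → lookup v x) ι≡τ))))
    (cong (λ J → rearrange ι J (cs (length J))) (mismatches-rotation I-s 2≤|I|))

  solvedInTwo⇒rotation : ∀ {τ : Vec (Fin n) n} → T (solvedInTwo τ) → rotation (mismatches ι τ) ≡ τ
  solvedInTwo⇒rotation = proj₂ ∘ solvedInTwo⁻

  hasFixedPoint-rotation : ∀ {I} → length I < n → T (hasFixedPoint (rotation I))
  hasFixedPoint-rotation {I} |I|<n with Fin.¬∀⟶∃¬ n (_∈ I) (_∈? I) (ℕ.<⇒≱ |I|<n ∘ universal⇒n≤length)
  ... | p , p∉I = meets⁺ id (rotation I) p (rotation-∉ p∉I)

  rotation-step : ∀ {I} → Sorted I → ∀ {p} → p ∈ I →
    (lookup (rotation I) p <ᶠ p × (∀ {q} → q ∈ I → lookup (rotation I) p <ᶠ q → q <ᶠ p → ⊥))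
    ⊎ (∀ {q} → q ∈ I → p ≤ᶠ q × q ≤ᶠ lookup (rotation I) p)
  rotation-step {I} I-s {p} p∈I = subst Step (sym p≡) (step-at (cs⁻¹ _ (Any.index p∈I)))
    where
    k : ℕ
    k = length I
    f : Fin k → Fin n
    f = List.lookup I
    τ : Vec (Fin n) n
    τ = rotation I
    p≡ : p ≡ f (cs k (cs⁻¹ k (Any.index p∈I)))
    p≡ = trans (lookup-index p∈I) (cong f (sym (cs-cs⁻¹ k _)))
    Step : Fin n → Set
    Step p = (lookup τ p <ᶠ p × (∀ {q} → q ∈ I → lookup τ p <ᶠ q → q <ᶠ p → ⊥))
             ⊎ (∀ {q} → q ∈ I → p ≤ᶠ q × q ≤ᶠ lookup τ p)
    τ-f : ∀ j → lookup τ (f (cs k j)) ≡ f j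
    τ-f j = trans (rearrange-∈ ι I-s (cs-injective k) j) (lookup-allFin (f j))
    step-at : ∀ j → Step (f (cs k j))
    step-at j rewrite τ-f j with toℕ-cs k j
    ... | inj₁ (_ , toℕ-csj) = inj₁ (lookup-strictMono I-s j<csj , between)
      where
      j<csj : j <ᶠ cs k j
      j<csj = subst (toℕ j <_) (sym toℕ-csj) (ℕ.n<1+n (toℕ j))
      between : ∀ {q} → q ∈ I → f j <ᶠ q → q <ᶠ f (cs k j) → ⊥
      between q∈I rewrite lookup-index q∈I = λ fj<fi fi<fcsj → ℕ.<⇒≱ (lookup-reflects-< I-s fj<fi)
        (ℕ.s≤s⁻¹ (subst (suc _ ≤_) toℕ-csj (lookup-reflects-< I-s fi<fcsj)))
    ... | inj₂ (j+1≡k , toℕ-csj≡0) = inj₂ within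
      where
      within : ∀ {q} → q ∈ I → f (cs k j) ≤ᶠ q × q ≤ᶠ f j
      within q∈I rewrite lookup-index q∈I = let i = Any.index q∈I in
          lookup-monotone I-s (subst (_≤ toℕ i) (sym toℕ-csj≡0) z≤n)
        , lookup-monotone I-s (ℕ.s≤s⁻¹ (subst (toℕ i <_) (sym j+1≡k) (Fin.toℕ<n i)))

  rotation-meets-cs-⊆ : 2 ≤ n → ∀ {I} → Sorted I → ∀ {x} → lookup (rotation I) x ≡ cs n x →
    ∀ {q} → q ∈ I → q ≡ x ⊎ q ≡ cs n x
  rotation-meets-cs-⊆ 2≤n {I} I-s {x} τx≡csx {q} q∈I = [ from-predecessor , from-extremes ]′
    (rotation-step I-s (moved⇒∈ λ τx≡x → cs-≢ 2≤n x (trans (sym τx≡csx) τx≡x)))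
    where
    τx : Fin n
    τx = lookup (rotation I) x
    toℕ-τx : toℕ τx ≡ toℕ (cs n x)
    toℕ-τx = cong toℕ τx≡csx
    from-predecessor : τx <ᶠ x × (∀ {q} → q ∈ I → τx <ᶠ q → q <ᶠ x → ⊥) → q ≡ x ⊎ q ≡ cs n x
    from-predecessor (τx<x , gap) with toℕ-cs n x
    ... | inj₁ (_ , toℕ-csx) =
      ⊥-elim (ℕ.<-asym τx<x (subst (toℕ x <_) (sym (trans toℕ-τx toℕ-csx)) (ℕ.n<1+n (toℕ x))))
    ... | inj₂ (x+1≡n , toℕ-csx≡0) with toℕ q ℕ.≟ 0
    ...   | yes toℕ-q≡0 = inj₂ (Fin.toℕ-injective (trans toℕ-q≡0 (sym toℕ-csx≡0)))
    ...   | no  toℕ-q≢0 = inj₁ (Fin.toℕ-injective (ℕ.≤-antisym q≤x (ℕ.≮⇒≥ (gap q∈I τx<q))))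
      where
      τx<q : τx <ᶠ q
      τx<q = subst (_< toℕ q) (sym (trans toℕ-τx toℕ-csx≡0)) (ℕ.n≢0⇒n>0 toℕ-q≢0)
      q≤x : toℕ q ≤ toℕ x
      q≤x = ℕ.s≤s⁻¹ (subst (toℕ q <_) (sym x+1≡n) (Fin.toℕ<n q))
    from-extremes : (∀ {q} → q ∈ I → x ≤ᶠ q × q ≤ᶠ τx) → q ≡ x ⊎ q ≡ cs n x
    from-extremes within with toℕ-cs n x | within q∈I
    ... | inj₂ (_ , toℕ-csx≡0) | _ , q≤τx = inj₂ (Fin.toℕ-injective
      (trans (ℕ.n≤0⇒n≡0 (subst (toℕ q ≤_) (trans toℕ-τx toℕ-csx≡0) q≤τx)) (sym toℕ-csx≡0)))
    ... | inj₁ (_ , toℕ-csx)   | x≤q , q≤τx with ℕ.m≤n⇒m<n∨m≡n x≤q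
    ...   | inj₂ toℕ-x≡q = inj₁ (Fin.toℕ-injective (sym toℕ-x≡q))
    ...   | inj₁ x<q     = inj₂ (Fin.toℕ-injective (ℕ.≤-antisym (subst (toℕ q ≤_) toℕ-τx q≤τx)
                                                               (subst (_≤ toℕ q) (sym toℕ-csx) x<q)))

  pair : Fin n → Fin n → List (Fin n)
  pair x y with x Fin.<? y
  ... | yes _ = x ∷ y ∷ []
  ... | no  _ = y ∷ x ∷ []

  length-pair : ∀ x y → length (pair x y) ≡ 2
  length-pair x y with x Fin.<? y
  ... | yes _ = refl
  ... | no  _ = refl

  module _ {x y : Fin n} where

    pair-sorted : x ≢ y → Sorted (pair x y)
    pair-sorted x≢y with x Fin.<? y
    ... | yes x<y = (x<y All.∷ All.[]) ∷ All.[] ∷ []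
    ... | no  x≮y = (Fin.≤∧≢⇒< (ℕ.≮⇒≥ x≮y) (x≢y ∘ sym) All.∷ All.[]) ∷ All.[] ∷ []

    ∈-pair⁻ : ∀ {z} → z ∈ pair x y → z ≡ x ⊎ z ≡ y
    ∈-pair⁻ z∈ with x Fin.<? y | z∈
    ... | yes _ | here z≡x         = inj₁ z≡x
    ... | yes _ | there (here z≡y) = inj₂ z≡y
    ... | no  _ | here z≡y         = inj₂ z≡y
    ... | no  _ | there (here z≡x) = inj₁ z≡x

    ∈-pair⁺ : ∀ {z} → z ≡ x ⊎ z ≡ y → z ∈ pair x y
    ∈-pair⁺ z≡ with x Fin.<? y | z≡
    ... | yes _ | inj₁ z≡x = here z≡x
    ... | yes _ | inj₂ z≡y = there (here z≡y)
    ... | no  _ | inj₁ z≡x = there (here z≡x)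
    ... | no  _ | inj₂ z≡y = here z≡y

    rotation-pair : x ≢ y → lookup (rotation (pair x y)) x ≡ y
    rotation-pair x≢y with x Fin.<? y | pair-sorted x≢y
    ... | yes _ | I-s = rotation-lookup I-s zero
    ... | no  _ | I-s = rotation-lookup I-s (suc zero)

  rotation-meets-cs : 2 ≤ n → ∀ {I} → Sorted I → ∀ {x} → lookup (rotation I) x ≡ cs n x →
    I ≡ pair x (cs n x)
  rotation-meets-cs 2≤n {I} I-s {x} τx≡csx = sorted-≡ I-s (pair-sorted x≢csx)
    (∈-pair⁺ ∘ rotation-meets-cs-⊆ 2≤n I-s τx≡csx)
    (λ q∈ → [ (λ { refl → x∈I }) , (λ { refl → subst (_∈ I) τx≡csx (rotation-∈ I-s x∈I) }) ]′
              (∈-pair⁻ q∈))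
    where
    x≢csx : x ≢ cs n x
    x≢csx = cs-≢ 2≤n x ∘ sym
    x∈I : x ∈ I
    x∈I = moved⇒∈ (λ τx≡x → x≢csx (trans (sym τx≡x) τx≡csx))

  three-cycle : ∀ {y z} → y ≢ z → z ≢ cs n y → ∃ λ I → Sorted I × length I ≡ 3 × lookup (rotation I) y ≡ z
  three-cycle {y} {z} y≢z z≢csy with Fin.<-cmp z y | toℕ-cs n y
  ... | tri≈ _ z≡y _ | _ = ⊥-elim (y≢z (sym z≡y))
  ... | tri< z<y _ _ | inj₁ (_ , toℕ-csy) =
    _ , sorted₃ z<y y<csy , refl , rotation-lookup (sorted₃ z<y y<csy) (suc zero)
    where
    y<csy : y <ᶠ cs n y
    y<csy = subst (toℕ y <_) (sym toℕ-csy) (ℕ.n<1+n (toℕ y))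
  ... | tri< z<y _ _ | inj₂ (_ , toℕ-csy≡0) =
    _ , sorted₃ csy<z z<y , refl , rotation-lookup (sorted₃ csy<z z<y) (suc (suc zero))
    where
    csy<z : cs n y <ᶠ z
    csy<z = subst (_< toℕ z) (sym toℕ-csy≡0)
      (ℕ.n≢0⇒n>0 λ toℕ-z≡0 → z≢csy (Fin.toℕ-injective (trans toℕ-z≡0 (sym toℕ-csy≡0))))
  ... | tri> _ _ y<z | inj₁ (_ , toℕ-csy) =
    _ , sorted₃ y<csy csy<z , refl , rotation-lookup (sorted₃ y<csy csy<z) zero
    where
    y<csy : y <ᶠ cs n y
    y<csy = subst (toℕ y <_) (sym toℕ-csy) (ℕ.n<1+n (toℕ y))
    csy<z : cs n y <ᶠ z
    csy<z = Fin.≤∧≢⇒< (subst (_≤ toℕ z) (sym toℕ-csy) y<z) (z≢csy ∘ sym)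
  ... | tri> _ _ y<z | inj₂ (y+1≡n , _) = ⊥-elim (ℕ.<⇒≱ (Fin.toℕ<n z) (subst (_≤ toℕ z) y+1≡n y<z))

-- Double counting

module _ {n : ℕ} where

  count-solvedInTwo-meets-cs : 2 ≤ n → count (λ τ → solvedInTwo τ ∧ meets (cs n) τ) (perms n) ≤ n
  count-solvedInTwo-meets-cs 2≤n =
    subst (count (λ τ → solvedInTwo τ ∧ meets (cs n) τ) (perms n) ≤_)
          (trans (length-map swapWithNext (List.allFin n)) (length-tabulate id))
          (count-≤-length (λ τ → solvedInTwo τ ∧ meets (cs n) τ) perms-unique covered)
    where
    swapWithNext : Fin n → Vec (Fin n) n
    swapWithNext x = rotation (pair x (cs n x))
    covered : ∀ {τ} → τ ∈ perms n → T (solvedInTwo τ ∧ meets (cs n) τ) →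
      τ ∈ List.map swapWithNext (List.allFin n)
    covered {τ} _ t with Equivalence.to T-∧ t
    ... | solved , meets-cs with meets⁻ (cs n) τ meets-cs
    ...   | x , τx≡csx = subst (_∈ _) τ≡ (∈-map⁺ swapWithNext (∈-allFin x))
      where
      τ-rotation : rotation (mismatches ι τ) ≡ τ
      τ-rotation = solvedInTwo⇒rotation solved
      τ≡ : swapWithNext x ≡ τ
      τ≡ = trans (cong rotation (sym (rotation-meets-cs 2≤n (mismatches-sorted ι τ)
             (trans (cong (λ v → lookup v x) τ-rotation) τx≡csx)))) τ-rotation

  count-solvedInTwo-deranged : 2 ≤ n → 1 ≤ count (λ τ → solvedInTwo τ ∧ not (hasFixedPoint τ)) (perms n)
  count-solvedInTwo-deranged 2≤n =
    length-≤-count (λ τ → solvedInTwo τ ∧ not (hasFixedPoint τ)) {ys = perms n} (All.[] ∷ []) λ { (here refl) →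
        rotation-∈-perms allFin-sorted
      , Equivalence.from T-∧ (solvedInTwo-rotation allFin-sorted 2≤|allFin|
                             , avoids⁺ id τ λ p → rotation-moves allFin-sorted 2≤|allFin| (∈-allFin p)) }
    where
    allFin-sorted : Sorted (List.allFin n)
    allFin-sorted = tabulate⁺-< id
    2≤|allFin| : 2 ≤ length (List.allFin n)
    2≤|allFin| = subst (2 ≤_) (sym (length-tabulate id)) 2≤n
    τ : Vec (Fin n) n
    τ = rotation (List.allFin n)

  module _ {σ : Fin n → Fin n} (σ-cyclic : IsCyclic σ) (4≤n : 4 ≤ n)
           {y₀ : Fin n} (σy₀≢csy₀ : σ y₀ ≢ cs n y₀) where

    private
      3≤n : 3 ≤ n
      3≤n = ℕ.≤-trans (ℕ.n≤1+n 3) 4≤n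
      2≤n : 2 ≤ n
      2≤n = ℕ.≤-trans (ℕ.n≤1+n 2) 3≤n
      σ-injective : Injective _≡_ _≡_ σ
      σ-injective = cyclic-injective σ-cyclic
      x≢σx : ∀ x → x ≢ σ x
      x≢σx x = cyclic-≢ σ-cyclic 2≤n x ∘ sym

    swapWithImage : Fin n → Vec (Fin n) n
    swapWithImage x = rotation (pair x (σ x))

    mismatches-swapWithImage : ∀ x → mismatches ι (swapWithImage x) ≡ pair x (σ x)
    mismatches-swapWithImage x = mismatches-rotation (pair-sorted (x≢σx x)) (ℕ.≤-reflexive (sym (length-pair x (σ x))))

    swapWithImage-injective : ∀ {x y} → swapWithImage x ≡ swapWithImage y → x ≡ y
    swapWithImage-injective {x} {y} eq with ∈-pair⁻ (subst (x ∈_) pairs≡ (∈-pair⁺ (inj₁ refl)))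
                                          | ∈-pair⁻ (subst (σ x ∈_) pairs≡ (∈-pair⁺ (inj₂ refl)))
      where
      pairs≡ : pair x (σ x) ≡ pair y (σ y)
      pairs≡ = trans (sym (mismatches-swapWithImage x)) (trans (cong (mismatches ι) eq) (mismatches-swapWithImage y))
    ... | inj₁ x≡y    | _          = x≡y
    ... | inj₂ _      | inj₂ σx≡σy = σ-injective σx≡σy
    ... | inj₂ x≡σy   | inj₁ σx≡y  = ⊥-elim (cyclic-≢² σ-cyclic 3≤n y (trans (cong σ (sym x≡σy)) σx≡y))

    private
      cycle₃ : ∃ λ I → Sorted I × length I ≡ 3 × lookup (rotation I) y₀ ≡ σ y₀
      cycle₃ = three-cycle (x≢σx y₀) σy₀≢csy₀
      I₃ : List (Fin n)
      I₃ = proj₁ cycle₃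
      I₃-sorted : Sorted I₃
      I₃-sorted = proj₁ (proj₂ cycle₃)
      |I₃|≡3 : length I₃ ≡ 3
      |I₃|≡3 = proj₁ (proj₂ (proj₂ cycle₃))
      2≤|I₃| : 2 ≤ length I₃
      2≤|I₃| = subst (2 ≤_) (sym |I₃|≡3) (ℕ.n≤1+n 2)

      rotation-solvedInTwoFixed-meets : ∀ {I} → Sorted I → 2 ≤ length I → length I < n →
        ∀ {x} → lookup (rotation I) x ≡ σ x →
        rotation I ∈ perms n × T (solvedInTwoFixed (rotation I) ∧ meets σ (rotation I))
      rotation-solvedInTwoFixed-meets {I} I-s 2≤|I| |I|<n {x} τx≡σx = rotation-∈-perms I-s
        , Equivalence.from T-∧ (Equivalence.from T-∧ (solvedInTwo-rotation I-s 2≤|I| , hasFixedPoint-rotation {I = I} |I|<n)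
                               , meets⁺ σ (rotation I) x τx≡σx)

    witnesses : List (Vec (Fin n) n)
    witnesses = rotation I₃ ∷ List.map swapWithImage (List.allFin n)

    witnesses-unique : Unique witnesses
    witnesses-unique = All.tabulate cycle≢swap ∷ Unique.map⁺ swapWithImage-injective (Unique.allFin⁺ n)
      where
      cycle≢swap : ∀ {w} → w ∈ List.map swapWithImage (List.allFin n) → rotation I₃ ≢ w
      cycle≢swap w∈ with ∈-map⁻ swapWithImage w∈
      ... | x , _ , refl = λ eq → ℕ.1+n≢n (begin
        3                                        ≡⟨ |I₃|≡3 ⟨
        length I₃                                ≡⟨ cong length (mismatches-rotation I₃-sorted 2≤|I₃|) ⟨
        length (mismatches ι (rotation I₃))      ≡⟨ cong (length ∘ mismatches ι) eq ⟩
        length (mismatches ι (swapWithImage x))  ≡⟨ cong length (mismatches-swapWithImage x) ⟩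
        length (pair x (σ x))                    ≡⟨ length-pair x (σ x) ⟩
        2                                        ∎)
        where open ≡-Reasoning

    count-solvedInTwoFixed-meets : suc n ≤ count (λ τ → solvedInTwoFixed τ ∧ meets σ τ) (perms n)
    count-solvedInTwoFixed-meets = subst (_≤ count (λ τ → solvedInTwoFixed τ ∧ meets σ τ) (perms n)) |witnesses|
      (length-≤-count (λ τ → solvedInTwoFixed τ ∧ meets σ τ) witnesses-unique all-good)
      where
      |witnesses| : length witnesses ≡ suc n
      |witnesses| = cong suc (trans (length-map swapWithImage (List.allFin n)) (length-tabulate id))
      all-good : ∀ {w} → w ∈ witnesses → w ∈ perms n × T (solvedInTwoFixed w ∧ meets σ w)
      all-good (here refl) = rotation-solvedInTwoFixed-meets I₃-sorted 2≤|I₃| (subst (_< n) (sym |I₃|≡3) 4≤n)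
                               (proj₂ (proj₂ (proj₂ cycle₃)))
      all-good (there w∈) with ∈-map⁻ swapWithImage w∈
      ... | x , _ , refl = rotation-solvedInTwoFixed-meets (pair-sorted (x≢σx x))
                             (ℕ.≤-reflexive (sym (length-pair x (σ x)))) (subst (_< n) (sym (length-pair x (σ x))) 3≤n)
                             (rotation-pair (x≢σx x))

    private
      Gσ : ℕ
      Gσ = count (λ τ → solvedInTwoFixed τ ∧ avoids σ τ) (perms n)
      Gcs : ℕ
      Gcs = count (λ τ → solvedInTwo τ ∧ avoids (cs n) τ) (perms n)

    -- Count the permutations solved in two guesses once split by a fixed point and agreement
    -- with σ, once by agreement with cs.
    solvedInTwo-avoiding-cs-exceeds : Gσ + 2 ≤ Gcs
    solvedInTwo-avoiding-cs-exceeds = ℕ.+-cancelˡ-≤ n _ _ (begin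
      n + (Gσ + 2)                ≡⟨ shuffle n Gσ ⟩
      (suc n + Gσ) + 1            ≤⟨ ℕ.+-mono-≤ (ℕ.+-monoˡ-≤ Gσ count-solvedInTwoFixed-meets)
                                                (count-solvedInTwo-deranged 2≤n) ⟩
      (Bσ + Gσ) + Deranged        ≡⟨ cong (_+ Deranged) (count-split solvedInTwoFixed (meets σ) (perms n)) ⟨
      Fixed + Deranged            ≡⟨ count-split solvedInTwo hasFixedPoint (perms n) ⟨
      count solvedInTwo (perms n) ≡⟨ count-split solvedInTwo (meets (cs n)) (perms n) ⟩
      Bcs + Gcs                   ≤⟨ ℕ.+-monoˡ-≤ Gcs (count-solvedInTwo-meets-cs 2≤n) ⟩
      n + Gcs                     ∎)
      where
      open ℕ.≤-Reasoning
      Fixed : ℕ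
      Fixed = count solvedInTwoFixed (perms n)
      Deranged : ℕ
      Deranged = count (λ τ → solvedInTwo τ ∧ not (hasFixedPoint τ)) (perms n)
      Bσ : ℕ
      Bσ = count (λ τ → solvedInTwoFixed τ ∧ meets σ τ) (perms n)
      Bcs : ℕ
      Bcs = count (λ τ → solvedInTwo τ ∧ meets (cs n) τ) (perms n)
      shuffle : ∀ n g → n + (g + 2) ≡ (suc n + g) + 1
      shuffle = solve-∀

    count-derangedEndsAt3-< : count (derangedEndsAt3 (inductiveS n σ)) (perms n) < count (derangedEndsAt3 CS) (perms n)
    count-derangedEndsAt3-< = begin-strict
      count (derangedEndsAt3 (inductiveS n σ)) (perms n)  ≤⟨ count-derangedEndsAt3-inductiveS σ-cyclic ⟩
      Gσ + 1                                              <⟨ ℕ.+-monoʳ-< Gσ (ℕ.n<1+n 1) ⟩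
      Gσ + 2                                              ≤⟨ solvedInTwo-avoiding-cs-exceeds ⟩
      Gcs                                                 ≤⟨ count-solvedInTwo-avoiding-cs 2≤n ⟩
      count (derangedEndsAt3 CS) (perms n)                ∎
      where open ℕ.≤-Reasoning

theorem4p3 : (n : ℕ) → 4 ≤ n → (σ : Fin n → Fin n) → IsCyclic σ →
    ¬ (∀ i → σ i ≡ cs n i) →
    coeff3 (inductiveS n σ) n < coeff3 CS n
theorem4p3 n 4≤n σ σ-cyclic σ≢cs = begin-strict
  coeff3 S n              ≡⟨ count-split (endsAt3 S) hasFixedPoint (perms n) ⟩
  Fixed S + Deranged S    ≡⟨ cong (_+ Deranged S) (count-cong (perms n) (endsAt3-inductiveS-∧-fixedPoint σ)) ⟩
  Fixed CS + Deranged S   <⟨ ℕ.+-monoʳ-< (Fixed CS) (count-derangedEndsAt3-< σ-cyclic 4≤n (proj₂ σ≢cs-at)) ⟩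
  Fixed CS + Deranged CS  ≡⟨ count-split (endsAt3 CS) hasFixedPoint (perms n) ⟨
  coeff3 CS n             ∎
  where
  open ℕ.≤-Reasoning
  S : Strategy
  S = inductiveS n σ
  Fixed Deranged : Strategy → ℕ
  Fixed T = count (λ π → endsAt3 T π ∧ hasFixedPoint π) (perms n)
  Deranged T = count (derangedEndsAt3 T) (perms n)
  σ≢cs-at : ∃ λ y → σ y ≢ cs n y
  σ≢cs-at = Fin.¬∀⟶∃¬ n _ (λ i → σ i ≟ cs n i) σ≢cs
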